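{- Let $q$ be a prime power. For every partition $\lambda$, under a uniformly random ring homomorphism $\Lambda\to\mathbb{F}_q$ we have $P(s_\lambda\mapsto 0)\geq 1/q$.
   Context: $\Lambda$ is the ring of symmetric functions over $\mathbb{Z}$, $h_k$ the complete homogeneous symmetric functions, $s_\lambda$ the Schur functions. A uniformly random ring homomorphism $\Lambda\to\mathbb{F}_q$ is obtained by sending $h_1,h_2,\dots$ to independent uniformly random elements of $\mathbb{F}_q$. $P(s_\lambda\mapsto 0)$ is the probability that $s_\lambda$ is sent to $0$. -}

module Defs where

open import Level using (Level; _⊔_) renaming (suc to lsuc)
open import Algebra.Bundles using (CommutativeRing)
open import Data.Nat as ℕ using (ℕ; zero; suc; _<_; _≥_)
open import Data.Integer as ℤ using (ℤ; +_; -[1+_])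
open import Data.Fin using (Fin; zero; suc; toℕ; punchIn)
open import Data.List using (List; []; _∷_; length; filter; concatMap; map)
open import Data.List.Relation.Unary.All using (All)
open import Data.List.Relation.Unary.Any using (Any)
open import Data.List.Relation.Unary.AllPairs using (AllPairs)
open import Data.List.Relation.Unary.Linked using (Linked)
open import Data.Vec using (Vec; []; _∷_; fromList; lookup; toList)
open import Data.Product using (∃)
open import Relation.Nullary using (¬_)
open import Relation.Binary using (Decidable)

-- Its order q = |elements|
-- is then automatically a prime power, and every prime power occurs.
record FiniteField (c ℓ : Level) : Set (lsuc (c ⊔ ℓ)) where
  field
    commRing : CommutativeRing c ℓ
  open CommutativeRing commRing public
  field
    _≟_      : Decidable _≈_
    elements : List Carrier
    complete : ∀ x → Any (x ≈_) elements
    distinct : AllPairs (λ x y → ¬ x ≈ y) elements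
    0≉1      : ¬ 0# ≈ 1#
    inverse  : ∀ x → ¬ x ≈ 0# → ∃ λ y → x * y ≈ 1#

  order : ℕ
  order = length elements

IsPartition : List ℕ → Set
IsPartition λp = Linked _≥_ λp × All (0 <_) λp
  where open import Data.Product using (_×_)

module _ {c ℓ} (F : FiniteField c ℓ) where
  open FiniteField F using (Carrier; elements; _≟_; _+_; _*_; -_; 0#; 1#)

  allVecs : (n : ℕ) → List (Vec Carrier n)
  allVecs zero    = [] ∷ []
  allVecs (suc n) = concatMap (λ x → map (x ∷_) (allVecs n)) elements

  sumFin : (n : ℕ) → (Fin n → Carrier) → Carrier
  sumFin zero    f = 0#
  sumFin (suc n) f = f zero + sumFin n (λ i → f (suc i))

  signed : ℕ → Carrier → Carrier
  signed zero          x = x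
  signed (suc zero)    x = - x
  signed (suc (suc k)) x = signed k x

  det : (n : ℕ) → (Fin n → Fin n → Carrier) → Carrier
  det zero    M = 1#
  det (suc n) M =
    sumFin (suc n) (λ j → signed (toℕ j)
      (M zero j * det n (λ i k → M (suc i) (punchIn j k))))

  -- h-values from a tuple (h_1, …, h_N): hOf v k = h_{k+1}  (0 beyond N)
  hOfList : List Carrier → ℕ → Carrier
  hOfList []       k       = 0#
  hOfList (x ∷ xs) zero    = x
  hOfList (x ∷ xs) (suc k) = hOfList xs k

  hAt : (ℕ → Carrier) → ℤ → Carrier
  hAt h -[1+ _ ]   = 0#
  hAt h (+ zero)   = 1#
  hAt h (+ suc k)  = h k

  -- image of the Schur function s_λ under the ring homomorphism Λ → F
  -- with h_k ↦ h (k-1), via Jacobi–Trudi: s_λ = det (h_{λ_i - i + j})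
  schurImage : (ℕ → Carrier) → List ℕ → Carrier
  schurImage h λp =
    det (length λp) (λ i j →
      hAt h ((+ lookup (fromList λp) i ℤ.- + toℕ i) ℤ.+ + toℕ j))

  zeroCount : List ℕ → (N : ℕ) → ℕ
  zeroCount λp N =
    length (filter (λ v → schurImage (hOfList (toList v)) λp ≟ 0#)
                   (allVecs N))

{-# OPTIONS --safe #-}
module Submission where

-- By Jacobi–Trudi, s_λ ↦ det (h_{λ_i − i + j}), which vanishes whenever this ℓ × ℓ matrix has a
-- nonzero kernel vector.  Without its first row (offset λ₁ = ρ + 1) the matrix is (ℓ − 1) × ℓ and always
-- has one, so it suffices that adding a top row of offset ρ + 1 to rows R of offsets ≤ ρ divides the number
-- of h with a kernel by at most q.  Let K(m, R) count the h for which the m-column matrix (h_{r+j}) has a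
-- kernel.  The entry h_{ρ+m+1} occurs in the rows R ∪ {ρ + 1} with m + 1 columns only in the top row, last
-- column.  Fixing the other variables, a kernel vector of width m + 1 for R either ends in 0, giving one of
-- width m, or can be completed to one for R ∪ {ρ + 1} by a suitable choice of h_{ρ+m+1}.  This gives
-- K(m+1, R) + q K(m, R ∪ {ρ+1}) ≤ K(m, R) + q K(m+1, R ∪ {ρ+1}), and induction on m yields
-- K(m, R) ≤ q K(m, R ∪ {ρ+1}).

open import Defs
open import Data.Nat using (ℕ; _≤_; _*_; _^_; _+_)
open import Data.List using (List; length)
open import Data.Nat.ListAction using (sum)

open import Level using (_⊔_)
open import Data.Nat as ℕ using (zero; suc; _<_; _≥_; z≤n; s≤s)
import Data.Nat.Properties as ℕ
open import Data.Fin as Fin using (Fin; zero; suc; toℕ; punchIn; punchOut; fromℕ; fromℕ<; inject₁)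
import Data.Fin.Properties as Fin
open import Data.List as List using ([]; _∷_; _++_; concatMap; filter)
import Data.List.Properties as ListP
open import Data.List.Relation.Unary.All as All using (All; []; _∷_)
import Data.List.Relation.Unary.All.Properties as AllP
open import Data.List.Relation.Unary.Any as Any using (Any; here; there)
import Data.List.Relation.Unary.Any.Properties as AnyP
open import Data.List.Relation.Unary.Linked using (Linked)
import Data.List.Relation.Unary.Linked.Properties as LinkedP
open import Data.Vec as Vec using (Vec; []; _∷_; _∷ʳ_; insertAt)
import Data.Vec.Properties as VecP
import Data.Vec.Relation.Unary.All.Properties as VecAllP
open import Data.Vec.Relation.Binary.Pointwise.Inductive as Pointwise using (Pointwise; []; _∷_)
open import Data.Product using (∃; _,_; _×_)
open import Data.Sum using (_⊎_; inj₁; inj₂)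
open import Data.Empty using (⊥-elim)
open import Function using (_∘_)
open import Relation.Nullary using (¬_; Dec; yes; no; ¬?; _×-dec_)
open import Relation.Unary using (Decidable)
open import Relation.Binary.Definitions using (tri<; tri≈; tri>)
open import Relation.Binary.PropositionalEquality as ≡ using (_≡_; _≢_)

module ListSum where

  open ≡ using (refl; sym; trans; cong; cong₂)

  ∑ : ∀ {a} {A : Set a} → List A → (A → ℕ) → ℕ
  ∑ []       f = 0
  ∑ (x ∷ xs) f = f x + ∑ xs f

  infix 5 ∑
  syntax ∑ xs (λ x → e) = ∑[ x ∈ xs ] e

  𝟙 : ∀ {p} {P : Set p} → Dec P → ℕ
  𝟙 (yes _) = 1
  𝟙 (no _)  = 0

  𝟙-yes : ∀ {p} {P : Set p} (P? : Dec P) → P → 𝟙 P? ≡ 1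
  𝟙-yes (yes _) _ = refl
  𝟙-yes (no ¬p) p = ⊥-elim (¬p p)

  𝟙-no : ∀ {p} {P : Set p} (P? : Dec P) → ¬ P → 𝟙 P? ≡ 0
  𝟙-no (yes p) ¬p = ⊥-elim (¬p p)
  𝟙-no (no _)  _  = refl

  𝟙-mono : ∀ {p q} {P : Set p} {Q : Set q} (P? : Dec P) (Q? : Dec Q) → (P → Q) → 𝟙 P? ≤ 𝟙 Q?
  𝟙-mono (yes p) (yes _) _   = ℕ.≤-refl
  𝟙-mono (yes p) (no ¬q) P→Q = ⊥-elim (¬q (P→Q p))
  𝟙-mono (no _)  _       _   = z≤n

  𝟙-cong : ∀ {p q} {P : Set p} {Q : Set q} (P? : Dec P) (Q? : Dec Q) → (P → Q) → (Q → P) → 𝟙 P? ≡ 𝟙 Q?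
  𝟙-cong P? Q? P→Q Q→P = ℕ.≤-antisym (𝟙-mono P? Q? P→Q) (𝟙-mono Q? P? Q→P)

  module _ {a} {A : Set a} where

    ∑-cong : ∀ (xs : List A) {f g : A → ℕ} → (∀ x → f x ≡ g x) → ∑ xs f ≡ ∑ xs g
    ∑-cong []       f≗g = refl
    ∑-cong (x ∷ xs) f≗g = cong₂ _+_ (f≗g x) (∑-cong xs f≗g)

    ∑-mono : ∀ (xs : List A) {f g : A → ℕ} → (∀ x → f x ≤ g x) → ∑ xs f ≤ ∑ xs g
    ∑-mono []       f≤g = z≤n
    ∑-mono (x ∷ xs) f≤g = ℕ.+-mono-≤ (f≤g x) (∑-mono xs f≤g)

    ∑-distrib-+ : ∀ (xs : List A) f g → ∑[ x ∈ xs ] (f x + g x) ≡ ∑ xs f + ∑ xs g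
    ∑-distrib-+ []       f g = refl
    ∑-distrib-+ (x ∷ xs) f g =
      trans (cong ((f x + g x) +_) (∑-distrib-+ xs f g)) (+-interchange (f x) (g x) (∑ xs f) (∑ xs g))
      where open import Algebra.Properties.CommutativeSemigroup ℕ.+-commutativeSemigroup renaming (interchange to +-interchange)

    *-distribˡ-∑ : ∀ (xs : List A) k f → ∑[ x ∈ xs ] (k * f x) ≡ k * ∑ xs f
    *-distribˡ-∑ []       k f = sym (ℕ.*-zeroʳ k)
    *-distribˡ-∑ (x ∷ xs) k f =
      trans (cong (k * f x +_) (*-distribˡ-∑ xs k f)) (sym (ℕ.*-distribˡ-+ k (f x) (∑ xs f)))

    ∑-const : ∀ (xs : List A) k → ∑[ x ∈ xs ] k ≡ length xs * k
    ∑-const []       k = refl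
    ∑-const (x ∷ xs) k = cong (k +_) (∑-const xs k)

    ∑-++ : ∀ (xs ys : List A) f → ∑ (xs ++ ys) f ≡ ∑ xs f + ∑ ys f
    ∑-++ []       ys f = refl
    ∑-++ (x ∷ xs) ys f = trans (cong (f x +_) (∑-++ xs ys f)) (sym (ℕ.+-assoc (f x) _ _))

    ∑-positive : ∀ {p} {P : A → Set p} (xs : List A) f → Any P xs → (∀ x → P x → 1 ≤ f x) → 1 ≤ ∑ xs f
    ∑-positive (x ∷ xs) f (here px)  pos = ℕ.≤-trans (pos x px) (ℕ.m≤m+n (f x) (∑ xs f))
    ∑-positive (x ∷ xs) f (there pxs) pos = ℕ.≤-trans (∑-positive xs f pxs pos) (ℕ.m≤n+m (∑ xs f) (f x))

    length-filter : ∀ {p} {P : A → Set p} (P? : Decidable P) xs → length (filter P? xs) ≡ ∑[ x ∈ xs ] 𝟙 (P? x)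
    length-filter P? []       = refl
    length-filter P? (x ∷ xs) with P? x
    ... | yes _ = cong suc (length-filter P? xs)
    ... | no _  = length-filter P? xs

  module _ {a b} {A : Set a} {B : Set b} where

    ∑-map : ∀ (g : A → B) (xs : List A) f → ∑ (List.map g xs) f ≡ ∑[ x ∈ xs ] f (g x)
    ∑-map g []       f = refl
    ∑-map g (x ∷ xs) f = cong (f (g x) +_) (∑-map g xs f)

    ∑-concatMap : ∀ (g : A → List B) (xs : List A) f → ∑ (concatMap g xs) f ≡ ∑[ x ∈ xs ] ∑ (g x) f
    ∑-concatMap g []       f = refl
    ∑-concatMap g (x ∷ xs) f = trans (∑-++ (g x) (concatMap g xs) f) (cong (∑ (g x) f +_) (∑-concatMap g xs f))

    ∑-comm : ∀ (xs : List A) (ys : List B) (f : A → B → ℕ) →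
             ∑[ x ∈ xs ] ∑[ y ∈ ys ] f x y ≡ ∑[ y ∈ ys ] ∑[ x ∈ xs ] f x y
    ∑-comm []       ys f = sym (trans (∑-const ys 0) (ℕ.*-zeroʳ (length ys)))
    ∑-comm (x ∷ xs) ys f =
      trans (cong (∑ ys (f x) +_) (∑-comm xs ys f)) (sym (∑-distrib-+ ys (f x) (λ y → ∑[ x′ ∈ xs ] f x′ y)))

module FinAdjacency where

  open ≡ using (refl; sym; cong)

  adjacent⇒≢ : ∀ {n} {c d : Fin n} → toℕ d ≡ suc (toℕ c) → c ≢ d
  adjacent⇒≢ adj refl = ℕ.1+n≢n (sym adj)

  punchIn-adjacent : ∀ {n} (c d : Fin (suc n)) → toℕ d ≡ suc (toℕ c) → ∀ k →
                     punchIn c k ≡ punchIn d k ⊎ (punchIn c k ≡ d × punchIn d k ≡ c)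
  punchIn-adjacent zero          (suc zero)    _  zero    = inj₂ (refl , refl)
  punchIn-adjacent zero          (suc zero)    _  (suc k) = inj₁ refl
  punchIn-adjacent (suc c)       (suc d)       _  zero    = inj₁ refl
  punchIn-adjacent {suc n} (suc c) (suc d) eq (suc k) with punchIn-adjacent c d (ℕ.suc-injective eq) k
  ... | inj₁ same        = inj₁ (cong suc same)
  ... | inj₂ (c↦d , d↦c) = inj₂ (cong suc c↦d , cong suc d↦c)

  punchOut-adjacent : ∀ {n} {j c d : Fin (suc n)} (j≢c : j ≢ c) (j≢d : j ≢ d) → toℕ d ≡ suc (toℕ c) →
                      toℕ (punchOut j≢d) ≡ suc (toℕ (punchOut j≢c))
  punchOut-adjacent {j = zero}  {zero}  j≢c _ _ = ⊥-elim (j≢c refl)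
  punchOut-adjacent {j = zero}  {suc c} {suc d} _ _ eq = ℕ.suc-injective eq
  punchOut-adjacent {suc n} {suc zero}    {zero} {suc zero} _ j≢d _ = ⊥-elim (j≢d refl)
  punchOut-adjacent {suc (suc n)} {suc (suc j)} {zero} {suc zero} _ _ _ = refl
  punchOut-adjacent {suc n} {suc j} {suc c} {suc d} j≢c j≢d eq =
    cong suc (punchOut-adjacent (j≢c ∘ cong suc) (j≢d ∘ cong suc) (ℕ.suc-injective eq))

module SumFin {c ℓ} (F : FiniteField c ℓ) where

  open FiniteField F hiding (zero) renaming (_+_ to _⊕_; _*_ to _·_)
  open import Relation.Binary.Reasoning.Setoid setoid

  sumFin-cong : ∀ n {f g : Fin n → Carrier} → (∀ i → f i ≈ g i) → sumFin F n f ≈ sumFin F n g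
  sumFin-cong zero    f≈g = refl
  sumFin-cong (suc n) f≈g = +-cong (f≈g zero) (sumFin-cong n (f≈g ∘ suc))

  sumFin-zero : ∀ n {f : Fin n → Carrier} → (∀ i → f i ≈ 0#) → sumFin F n f ≈ 0#
  sumFin-zero zero    f≈0 = refl
  sumFin-zero (suc n) f≈0 = trans (+-cong (f≈0 zero) (sumFin-zero n (f≈0 ∘ suc))) (+-identityˡ 0#)

  sumFin-linear : ∀ n a b (f g : Fin n → Carrier) →
                  sumFin F n (λ i → a · f i ⊕ b · g i) ≈ a · sumFin F n f ⊕ b · sumFin F n g
  sumFin-linear zero    a b f g = sym (trans (+-cong (zeroʳ a) (zeroʳ b)) (+-identityˡ 0#))
  sumFin-linear (suc n) a b f g = begin
    (a · f zero ⊕ b · g zero) ⊕ sumFin F n (λ i → a · f (suc i) ⊕ b · g (suc i))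
      ≈⟨ +-congˡ (sumFin-linear n a b (f ∘ suc) (g ∘ suc)) ⟩
    (a · f zero ⊕ b · g zero) ⊕ (a · sumFin F n (f ∘ suc) ⊕ b · sumFin F n (g ∘ suc))
      ≈⟨ +-interchange _ _ _ _ ⟩
    (a · f zero ⊕ a · sumFin F n (f ∘ suc)) ⊕ (b · g zero ⊕ b · sumFin F n (g ∘ suc))
      ≈⟨ +-cong (distribˡ a _ _) (distribˡ b _ _) ⟨
    a · sumFin F (suc n) f ⊕ b · sumFin F (suc n) g ∎
    where open import Algebra.Properties.CommutativeSemigroup +-commutativeSemigroup renaming (interchange to +-interchange)

  sumFin-single : ∀ n (f : Fin n → Carrier) k → (∀ j → j ≢ k → f j ≈ 0#) → sumFin F n f ≈ f k
  sumFin-single (suc n) f zero    f≈0 =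
    trans (+-congˡ (sumFin-zero n (λ i → f≈0 (suc i) λ ()))) (+-identityʳ (f zero))
  sumFin-single (suc n) f (suc k) f≈0 =
    trans (+-cong (f≈0 zero λ ()) (sumFin-single n (f ∘ suc) k (λ j j≢k → f≈0 (suc j) (j≢k ∘ Fin.suc-injective))))
          (+-identityˡ (f (suc k)))

  sumFin-pair : ∀ n (f : Fin n → Carrier) {c d} → c ≢ d → (∀ j → j ≢ c → j ≢ d → f j ≈ 0#) →
                sumFin F n f ≈ f c ⊕ f d
  sumFin-pair (suc n) f {zero}  {zero}  c≢d f≈0 = ⊥-elim (c≢d ≡.refl)
  sumFin-pair (suc n) f {zero}  {suc d} c≢d f≈0 =
    +-congˡ (sumFin-single n (f ∘ suc) d (λ j j≢d → f≈0 (suc j) (λ ()) (j≢d ∘ Fin.suc-injective)))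
  sumFin-pair (suc n) f {suc c} {zero}  c≢d f≈0 =
    trans (+-congˡ (sumFin-single n (f ∘ suc) c (λ j j≢c → f≈0 (suc j) (j≢c ∘ Fin.suc-injective) (λ ()))))
          (+-comm (f zero) (f (suc c)))
  sumFin-pair (suc n) f {suc c} {suc d} c≢d f≈0 =
    trans (+-cong (f≈0 zero (λ ()) (λ ()))
                  (sumFin-pair n (f ∘ suc) (c≢d ∘ ≡.cong suc)
                     (λ j j≢c j≢d → f≈0 (suc j) (j≢c ∘ Fin.suc-injective) (j≢d ∘ Fin.suc-injective))))
          (+-identityˡ _)

module Determinant {c ℓ} (F : FiniteField c ℓ) where

  open FiniteField F hiding (zero) renaming (_+_ to _⊕_; _*_ to _·_)
  open import Algebra.Properties.Ring ring using (-0#≈0#; -‿involutive; -‿+-comm; -‿distribʳ-*)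
  open import Algebra.Properties.CommutativeSemigroup *-commutativeSemigroup using (x∙yz≈y∙xz)
  open import Relation.Binary.Reasoning.Setoid setoid
  open FinAdjacency
  open SumFin F

  signed-cong : ∀ k {x y} → x ≈ y → signed F k x ≈ signed F k y
  signed-cong zero          x≈y = x≈y
  signed-cong (suc zero)    x≈y = -‿cong x≈y
  signed-cong (suc (suc k)) x≈y = signed-cong k x≈y

  signed-0# : ∀ k → signed F k 0# ≈ 0#
  signed-0# zero          = refl
  signed-0# (suc zero)    = -0#≈0#
  signed-0# (suc (suc k)) = signed-0# k

  signed-suc : ∀ k x → signed F (suc k) x ≈ - signed F k x
  signed-suc zero    x = refl
  signed-suc (suc k) x = sym (trans (-‿cong (signed-suc k x)) (-‿involutive _))

  signed-linear : ∀ k a b x y → signed F k (a · x ⊕ b · y) ≈ a · signed F k x ⊕ b · signed F k y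
  signed-linear zero          a b x y = refl
  signed-linear (suc zero)    a b x y =
    trans (sym (-‿+-comm (a · x) (b · y))) (+-cong (-‿distribʳ-* a x) (-‿distribʳ-* b y))
  signed-linear (suc (suc k)) a b x y = signed-linear k a b x y

  Matrix : ℕ → Set c
  Matrix n = Fin n → Fin n → Carrier

  minor : ∀ {n} → Fin (suc n) → Matrix (suc n) → Matrix n
  minor j M i k = M (suc i) (punchIn j k)

  AgreeOff : ∀ {n} → Fin n → Matrix n → Matrix n → Set ℓ
  AgreeOff k M M′ = ∀ i j → j ≢ k → M i j ≈ M′ i j

  det-cong : ∀ n {M M′ : Matrix n} → (∀ i j → M i j ≈ M′ i j) → det F n M ≈ det F n M′
  det-cong zero    M≈M′ = refl
  det-cong (suc n) M≈M′ = sumFin-cong (suc n) λ j →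
    signed-cong (toℕ j) (*-cong (M≈M′ zero j) (det-cong n λ i k → M≈M′ (suc i) (punchIn j k)))

  det-linear : ∀ n (k : Fin n) a b {M M₁ M₂ : Matrix n} → AgreeOff k M M₁ → AgreeOff k M M₂ →
               (∀ i → M i k ≈ a · M₁ i k ⊕ b · M₂ i k) → det F n M ≈ a · det F n M₁ ⊕ b · det F n M₂
  det-linear (suc n) k a b {M} {M₁} {M₂} M≈M₁ M≈M₂ Mk≈ = trans
    (sumFin-cong (suc n) λ j → trans (signed-cong (toℕ j) (expand j)) (signed-linear (toℕ j) a b _ _))
    (sumFin-linear (suc n) a b (term M₁) (term M₂))
    where
    term : Matrix (suc n) → Fin (suc n) → Carrier
    term X j = signed F (toℕ j) (X zero j · det F n (minor j X))

    expand : ∀ j → M zero j · det F n (minor j M)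
                   ≈ a · (M₁ zero j · det F n (minor j M₁)) ⊕ b · (M₂ zero j · det F n (minor j M₂))
    expand j with j Fin.≟ k
    ... | yes ≡.refl = begin
      M zero j · det F n (minor j M)
        ≈⟨ *-congʳ (Mk≈ zero) ⟩
      (a · M₁ zero j ⊕ b · M₂ zero j) · det F n (minor j M)
        ≈⟨ distribʳ _ _ _ ⟩
      (a · M₁ zero j) · det F n (minor j M) ⊕ (b · M₂ zero j) · det F n (minor j M)
        ≈⟨ +-cong (*-congˡ (minor-same M≈M₁)) (*-congˡ (minor-same M≈M₂)) ⟩
      (a · M₁ zero j) · det F n (minor j M₁) ⊕ (b · M₂ zero j) · det F n (minor j M₂)
        ≈⟨ +-cong (*-assoc _ _ _) (*-assoc _ _ _) ⟩
      a · (M₁ zero j · det F n (minor j M₁)) ⊕ b · (M₂ zero j · det F n (minor j M₂)) ∎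
      where
      minor-same : ∀ {X} → AgreeOff k M X → det F n (minor j M) ≈ det F n (minor j X)
      minor-same M≈X = det-cong n λ i l → M≈X (suc i) (punchIn j l) (Fin.punchInᵢ≢i j l)
    ... | no j≢k = begin
      M zero j · det F n (minor j M)
        ≈⟨ *-congˡ (det-linear n k′ a b (minor-agree M≈M₁) (minor-agree M≈M₂) minor-k) ⟩
      M zero j · (a · det F n (minor j M₁) ⊕ b · det F n (minor j M₂))
        ≈⟨ distribˡ _ _ _ ⟩
      M zero j · (a · det F n (minor j M₁)) ⊕ M zero j · (b · det F n (minor j M₂))
        ≈⟨ +-cong (x∙yz≈y∙xz _ a _) (x∙yz≈y∙xz _ b _) ⟩
      a · (M zero j · det F n (minor j M₁)) ⊕ b · (M zero j · det F n (minor j M₂))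
        ≈⟨ +-cong (*-congˡ (*-congʳ (M≈M₁ zero j j≢k))) (*-congˡ (*-congʳ (M≈M₂ zero j j≢k))) ⟩
      a · (M₁ zero j · det F n (minor j M₁)) ⊕ b · (M₂ zero j · det F n (minor j M₂)) ∎
      where
      k′ : Fin n
      k′ = punchOut j≢k
      punchIn-k′ : punchIn j k′ ≡ k
      punchIn-k′ = Fin.punchIn-punchOut j≢k
      minor-agree : ∀ {X} → AgreeOff k M X → AgreeOff k′ (minor j M) (minor j X)
      minor-agree M≈X i l l≢k′ =
        M≈X (suc i) (punchIn j l) (λ eq → l≢k′ (Fin.punchIn-injective j l k′ (≡.trans eq (≡.sym punchIn-k′))))
      minor-k : ∀ i → minor j M i k′ ≈ a · minor j M₁ i k′ ⊕ b · minor j M₂ i k′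
      minor-k i = ≡.subst (λ l → M (suc i) l ≈ a · M₁ (suc i) l ⊕ b · M₂ (suc i) l) (≡.sym punchIn-k′) (Mk≈ (suc i))

  det-adjacent-columns : ∀ n {M : Matrix n} (c d : Fin n) → toℕ d ≡ suc (toℕ c) →
                         (∀ i → M i c ≈ M i d) → det F n M ≈ 0#
  det-adjacent-columns (suc n) {M} c d adj Mc≈Md =
    trans (sumFin-pair (suc n) term (adjacent⇒≢ adj) other) (trans (+-congˡ term-d) (-‿inverseʳ (term c)))
    where
    term : Fin (suc n) → Carrier
    term j = signed F (toℕ j) (M zero j · det F n (minor j M))

    other : ∀ j → j ≢ c → j ≢ d → term j ≈ 0#
    other j j≢c j≢d = trans (signed-cong (toℕ j) (trans (*-congˡ minor≈0) (zeroʳ _))) (signed-0# (toℕ j))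
      where
      minor≈0 : det F n (minor j M) ≈ 0#
      minor≈0 = det-adjacent-columns n (punchOut j≢c) (punchOut j≢d) (punchOut-adjacent j≢c j≢d adj) λ i →
        ≡.subst₂ (λ x y → M (suc i) x ≈ M (suc i) y)
                 (≡.sym (Fin.punchIn-punchOut j≢c)) (≡.sym (Fin.punchIn-punchOut j≢d)) (Mc≈Md (suc i))

    same-minor : ∀ i k → minor d M i k ≈ minor c M i k
    same-minor i k with punchIn-adjacent c d adj k
    ... | inj₁ same        = reflexive (≡.cong (M (suc i)) (≡.sym same))
    ... | inj₂ (c↦d , d↦c) = ≡.subst₂ (λ x y → M (suc i) x ≈ M (suc i) y) (≡.sym d↦c) (≡.sym c↦d) (Mc≈Md (suc i))

    term-d : term d ≈ - term c
    term-d = begin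
      signed F (toℕ d) (M zero d · det F n (minor d M))
        ≡⟨ ≡.cong (λ t → signed F t (M zero d · det F n (minor d M))) adj ⟩
      signed F (suc (toℕ c)) (M zero d · det F n (minor d M))
        ≈⟨ signed-suc (toℕ c) _ ⟩
      - signed F (toℕ c) (M zero d · det F n (minor d M))
        ≈⟨ -‿cong (signed-cong (toℕ c) (*-cong (sym (Mc≈Md zero)) (det-cong n same-minor))) ⟩
      - term c ∎

  det-additive : ∀ n (k : Fin n) {M M₁ M₂ : Matrix n} → AgreeOff k M M₁ → AgreeOff k M M₂ →
                 (∀ i → M i k ≈ M₁ i k ⊕ M₂ i k) → det F n M ≈ det F n M₁ ⊕ det F n M₂
  det-additive n k M≈M₁ M≈M₂ Mk≈ =
    trans (det-linear n k 1# 1# M≈M₁ M≈M₂ (λ i → trans (Mk≈ i) (sym (1·x⊕1·y _ _)))) (1·x⊕1·y _ _)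
    where
    1·x⊕1·y : ∀ x y → 1# · x ⊕ 1# · y ≈ x ⊕ y
    1·x⊕1·y x y = +-cong (*-identityˡ x) (*-identityˡ y)

  setCol : ∀ {n} → Matrix n → Fin n → (Fin n → Carrier) → Matrix n
  setCol M k u i j with j Fin.≟ k
  ... | yes _ = u i
  ... | no _  = M i j

  setCol-≡ : ∀ {n} (M : Matrix n) k u i → setCol M k u i k ≡ u i
  setCol-≡ M k u i with k Fin.≟ k
  ... | yes _  = ≡.refl
  ... | no k≢k = ⊥-elim (k≢k ≡.refl)

  setCol-≢ : ∀ {n} (M : Matrix n) k u i {j} → j ≢ k → setCol M k u i j ≡ M i j
  setCol-≢ M k u i {j} j≢k with j Fin.≟ k
  ... | yes j≡k = ⊥-elim (j≢k j≡k)
  ... | no _    = ≡.refl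

  setCol-self : ∀ {n} (M : Matrix n) k {u} → (∀ i → u i ≡ M i k) → ∀ i j → setCol M k u i j ≡ M i j
  setCol-self M k u≡Mk i j with j Fin.≟ k
  ... | yes ≡.refl = u≡Mk i
  ... | no _       = ≡.refl

  setCol-cong : ∀ {n} (M : Matrix n) k {u} v → (∀ i → u i ≈ v i) → ∀ i j → setCol M k u i j ≈ setCol M k v i j
  setCol-cong M k v u≈v i j with j Fin.≟ k
  ... | yes _ = u≈v i
  ... | no _  = refl

  setCol-agreeOff : ∀ {n} (M : Matrix n) k u v → AgreeOff k (setCol M k u) (setCol M k v)
  setCol-agreeOff M k u v i j j≢k = reflexive (≡.trans (setCol-≢ M k u i j≢k) (≡.sym (setCol-≢ M k v i j≢k)))

  setCol-preserves-agreeOff : ∀ {n} {M M′ : Matrix n} {k} d v → AgreeOff k M M′ →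
                              AgreeOff k (setCol M d v) (setCol M′ d v)
  setCol-preserves-agreeOff d v M≈M′ i j j≢k with j Fin.≟ d
  ... | yes _ = refl
  ... | no _  = M≈M′ i j j≢k

  det-setCol-0# : ∀ n (M : Matrix n) k → det F n (setCol M k (λ _ → 0#)) ≈ 0#
  det-setCol-0# n M k =
    trans (det-linear n k 0# 0# {M₁ = M} {M₂ = M} agree agree λ i → trans (reflexive (setCol-≡ M k _ i)) (sym 0·x⊕0·y≈0))
          0·x⊕0·y≈0
    where
    agree : AgreeOff k (setCol M k (λ _ → 0#)) M
    agree i j j≢k = reflexive (setCol-≢ M k _ i j≢k)
    0·x⊕0·y≈0 : ∀ {x y} → 0# · x ⊕ 0# · y ≈ 0#
    0·x⊕0·y≈0 = trans (+-cong (zeroˡ _) (zeroˡ _)) (+-identityˡ 0#)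

  det-swap-adjacent : ∀ n (M : Matrix n) (c d : Fin n) → toℕ d ≡ suc (toℕ c) → ∀ u v →
                      det F n (setCol (setCol M c u) d v) ⊕ det F n (setCol (setCol M c v) d u) ≈ 0#
  det-swap-adjacent n M c d adj u v = begin
      B u v ⊕ B v u                      ≈⟨ +-cong (+-identityˡ _) (+-identityʳ _) ⟨
      (0# ⊕ B u v) ⊕ (B v u ⊕ 0#)        ≈⟨ +-cong (+-congʳ (diagonal u)) (+-congˡ (diagonal v)) ⟨
      (B u u ⊕ B u v) ⊕ (B v u ⊕ B v v)  ≈⟨ +-cong (additiveʳ u u v) (additiveʳ v u v) ⟨
      B u (u ⊹ v) ⊕ B v (u ⊹ v)          ≈⟨ additiveˡ u v (u ⊹ v) ⟨
      B (u ⊹ v) (u ⊹ v)                  ≈⟨ diagonal (u ⊹ v) ⟩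
      0#                                 ∎
    where
    _⊹_ : (Fin n → Carrier) → (Fin n → Carrier) → Fin n → Carrier
    (u ⊹ v) i = u i ⊕ v i

    T : (Fin n → Carrier) → (Fin n → Carrier) → Matrix n
    T x y = setCol (setCol M c x) d y

    B : (Fin n → Carrier) → (Fin n → Carrier) → Carrier
    B x y = det F n (T x y)

    T-c : ∀ x y i → T x y i c ≡ x i
    T-c x y i = ≡.trans (setCol-≢ (setCol M c x) d y i (adjacent⇒≢ adj)) (setCol-≡ M c x i)

    T-d : ∀ x y i → T x y i d ≡ y i
    T-d x y i = setCol-≡ (setCol M c x) d y i

    diagonal : ∀ x → B x x ≈ 0#
    diagonal x = det-adjacent-columns n c d adj λ i → reflexive (≡.trans (T-c x x i) (≡.sym (T-d x x i)))

    additiveˡ : ∀ x y z → B (x ⊹ y) z ≈ B x z ⊕ B y z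
    additiveˡ x y z = det-additive n c
      (setCol-preserves-agreeOff d z (setCol-agreeOff M c (x ⊹ y) x))
      (setCol-preserves-agreeOff d z (setCol-agreeOff M c (x ⊹ y) y))
      λ i → reflexive (≡.trans (T-c (x ⊹ y) z i) (≡.sym (≡.cong₂ _⊕_ (T-c x z i) (T-c y z i))))

    additiveʳ : ∀ x y z → B x (y ⊹ z) ≈ B x y ⊕ B x z
    additiveʳ x y z = det-additive n d
      (setCol-agreeOff (setCol M c x) d (y ⊹ z) y)
      (setCol-agreeOff (setCol M c x) d (y ⊹ z) z)
      λ i → reflexive (≡.trans (T-d x (y ⊹ z) i) (≡.sym (≡.cong₂ _⊕_ (T-d x y i) (T-d x z i))))

  -- Transposing d with its left neighbour d′ flips the sign and moves the copy of column c one step closer.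
  det-equal-columns-gap : ∀ n g {M : Matrix n} (c d : Fin n) → suc (toℕ c + g) ≡ toℕ d →
                          (∀ i → M i c ≈ M i d) → det F n M ≈ 0#
  det-equal-columns-gap n zero    c d gap Mc≈Md =
    det-adjacent-columns n c d (≡.trans (≡.sym gap) (≡.cong suc (ℕ.+-identityʳ (toℕ c)))) Mc≈Md
  det-equal-columns-gap n (suc g) {M} c d gap Mc≈Md = begin
      det F n M               ≈⟨ +-identityʳ _ ⟨
      det F n M ⊕ 0#          ≈⟨ +-congˡ det-M′≈0 ⟨
      det F n M ⊕ det F n M′  ≈⟨ +-congʳ (det-cong n λ i j → reflexive M≡T) ⟩
      det F n T ⊕ det F n M′  ≈⟨ det-swap-adjacent n M d′ d adj (col d′) (col d) ⟩
      0#                      ∎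
    where
    col : Fin n → Fin n → Carrier
    col j i = M i j

    gap′ : suc (suc (toℕ c + g)) ≡ toℕ d
    gap′ = ≡.trans (≡.cong suc (≡.sym (ℕ.+-suc (toℕ c) g))) gap
    d′<n : suc (toℕ c + g) < n
    d′<n = ℕ.<-trans (ℕ.n<1+n _) (≡.subst (_< n) (≡.sym gap′) (Fin.toℕ<n d))
    d′ : Fin n
    d′ = fromℕ< d′<n
    toℕ-d′ : suc (toℕ c + g) ≡ toℕ d′
    toℕ-d′ = ≡.sym (Fin.toℕ-fromℕ< d′<n)
    adj : toℕ d ≡ suc (toℕ d′)
    adj = ≡.trans (≡.sym gap′) (≡.cong suc toℕ-d′)

    T M′ : Matrix n
    T  = setCol (setCol M d′ (col d′)) d (col d)
    M′ = setCol (setCol M d′ (col d)) d (col d′)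

    d≢d′ : d ≢ d′
    d≢d′ = ≡.≢-sym (adjacent⇒≢ adj)
    c≢d′ : c ≢ d′
    c≢d′ c≡d′ = ℕ.m≢1+m+n (toℕ c) (≡.trans (≡.cong toℕ c≡d′) (≡.sym toℕ-d′))
    c≢d : c ≢ d
    c≢d c≡d = ℕ.m≢1+m+n (toℕ c) (≡.trans (≡.cong toℕ c≡d) (≡.sym gap))

    M≡T : ∀ {i j} → M i j ≡ T i j
    M≡T {i} {j} = ≡.sym (≡.trans (setCol-self _ d (λ i → ≡.sym (setCol-≢ M d′ (col d′) i d≢d′)) i j)
                                 (setCol-self M d′ (λ _ → ≡.refl) i j))

    det-M′≈0 : det F n M′ ≈ 0#
    det-M′≈0 = det-equal-columns-gap n g c d′ toℕ-d′ λ i → begin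
      M′ i c  ≡⟨ ≡.trans (setCol-≢ _ d _ i c≢d) (setCol-≢ M d′ _ i c≢d′) ⟩
      M i c   ≈⟨ Mc≈Md i ⟩
      M i d   ≡⟨ ≡.sym (≡.trans (setCol-≢ _ d _ i (d≢d′ ∘ ≡.sym)) (setCol-≡ M d′ _ i)) ⟩
      M′ i d′ ∎

  det-equal-columns : ∀ n {M : Matrix n} (c d : Fin n) → c ≢ d → (∀ i → M i c ≈ M i d) → det F n M ≈ 0#
  det-equal-columns n c d c≢d Mc≈Md with ℕ.<-cmp (toℕ c) (toℕ d)
  ... | tri< c<d _ _ = let g , gap = ℕ.m≤n⇒∃[o]m+o≡n c<d in det-equal-columns-gap n g c d gap Mc≈Md
  ... | tri≈ _ c≡d _ = ⊥-elim (c≢d (Fin.toℕ-injective c≡d))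
  ... | tri> _ _ d<c = let g , gap = ℕ.m≤n⇒∃[o]m+o≡n d<c in det-equal-columns-gap n g d c gap (sym ∘ Mc≈Md)

  det-setCol-sum : ∀ n m (M : Matrix n) k (a : Fin m → Carrier) (U : Fin m → Fin n → Carrier) →
                   det F n (setCol M k (λ i → sumFin F m (λ t → a t · U t i)))
                     ≈ sumFin F m (λ t → a t · det F n (setCol M k (U t)))
  det-setCol-sum n zero    M k a U = det-setCol-0# n M k
  det-setCol-sum n (suc m) M k a U = begin
      det F n (setCol M k (λ i → a zero · U zero i ⊕ rest i))
        ≈⟨ det-linear n k (a zero) 1# (setCol-agreeOff M k _ (U zero)) (setCol-agreeOff M k _ rest) column-k ⟩
      a zero · det F n (setCol M k (U zero)) ⊕ 1# · det F n (setCol M k rest)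
        ≈⟨ +-congˡ (trans (*-identityˡ _) (det-setCol-sum n m M k (a ∘ suc) (U ∘ suc))) ⟩
      sumFin F (suc m) (λ t → a t · det F n (setCol M k (U t))) ∎
    where
    rest : Fin n → Carrier
    rest i = sumFin F m (λ t → a (suc t) · U (suc t) i)
    column-k : ∀ i → setCol M k (λ i → a zero · U zero i ⊕ rest i) i k
                     ≈ a zero · setCol M k (U zero) i k ⊕ 1# · setCol M k rest i k
    column-k i = begin
      setCol M k _ i k
        ≡⟨ setCol-≡ M k _ i ⟩
      a zero · U zero i ⊕ rest i
        ≈⟨ +-congˡ (*-identityˡ (rest i)) ⟨
      a zero · U zero i ⊕ 1# · rest i
        ≡⟨ ≡.cong₂ (λ x y → a zero · x ⊕ 1# · y) (setCol-≡ M k (U zero) i) (setCol-≡ M k rest i) ⟨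
      a zero · setCol M k (U zero) i k ⊕ 1# · setCol M k rest i k ∎

  -- Replacing column k by ∑ w t · (column t), which is zero, expands by multilinearity into w k · det M
  -- plus determinants with two equal columns.
  det-dependent-columns : ∀ n (M : Matrix n) (w : Fin n → Carrier) k → ¬ w k ≈ 0# →
                          (∀ i → sumFin F n (λ t → w t · M i t) ≈ 0#) → det F n M ≈ 0#
  det-dependent-columns n M w k wk≉0 dependent = x·y≈0⇒y≈0 wk≉0 (begin
      w k · det F n M
        ≈⟨ *-congˡ (det-cong n λ i j → reflexive (≡.sym (setCol-self M k (λ _ → ≡.refl) i j))) ⟩
      w k · det F n (setCol M k (col k))
        ≈⟨ sumFin-single n (λ t → w t · det F n (setCol M k (col t))) k other ⟨
      sumFin F n (λ t → w t · det F n (setCol M k (col t)))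
        ≈⟨ det-setCol-sum n n M k w col ⟨
      det F n (setCol M k (λ i → sumFin F n (λ t → w t · M i t)))
        ≈⟨ det-cong n (λ i j → setCol-cong M k (λ _ → 0#) dependent i j) ⟩
      det F n (setCol M k (λ _ → 0#))
        ≈⟨ det-setCol-0# n M k ⟩
      0# ∎)
    where
    col : Fin n → Fin n → Carrier
    col t i = M i t

    other : ∀ t → t ≢ k → w t · det F n (setCol M k (col t)) ≈ 0#
    other t t≢k = trans (*-congˡ (det-equal-columns n k t (t≢k ∘ ≡.sym) λ i →
                    reflexive (≡.trans (setCol-≡ M k (col t) i) (≡.sym (setCol-≢ M k (col t) i t≢k)))))
                  (zeroʳ (w t))

    x·y≈0⇒y≈0 : ∀ {x y} → ¬ x ≈ 0# → x · y ≈ 0# → y ≈ 0#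
    x·y≈0⇒y≈0 {x} {y} x≉0 xy≈0 with inverse x x≉0
    ... | x⁻¹ , x·x⁻¹≈1 = begin
      y               ≈⟨ *-identityˡ y ⟨
      1# · y          ≈⟨ *-congʳ (trans (sym x·x⁻¹≈1) (*-comm x x⁻¹)) ⟩
      (x⁻¹ · x) · y   ≈⟨ *-assoc x⁻¹ x y ⟩
      x⁻¹ · (x · y)   ≈⟨ *-congˡ xy≈0 ⟩
      x⁻¹ · 0#        ≈⟨ zeroʳ x⁻¹ ⟩
      0#              ∎

module Enumeration {c ℓ} (F : FiniteField c ℓ) where

  open FiniteField F using (Carrier; _≈_; elements; complete; order)
  open ListSum
  open ≡.≡-Reasoning

  ∑-allVecs-suc : ∀ n (f : Vec Carrier (suc n) → ℕ) →
                  ∑ (allVecs F (suc n)) f ≡ ∑[ x ∈ elements ] ∑[ v ∈ allVecs F n ] f (x ∷ v)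
  ∑-allVecs-suc n f = ≡.trans (∑-concatMap (λ x → List.map (x ∷_) (allVecs F n)) elements f)
                              (∑-cong elements λ x → ∑-map (x ∷_) (allVecs F n) f)

  ∑-allVecs-insertAt : ∀ n (i : Fin (suc n)) (f : Vec Carrier (suc n) → ℕ) →
                       ∑ (allVecs F (suc n)) f ≡ ∑[ w ∈ allVecs F n ] ∑[ x ∈ elements ] f (insertAt w i x)
  ∑-allVecs-insertAt n       zero    f = ≡.trans (∑-allVecs-suc n f) (∑-comm elements (allVecs F n) λ x w → f (x ∷ w))
  ∑-allVecs-insertAt (suc n) (suc i) f = begin
      ∑ (allVecs F (suc (suc n))) f
        ≡⟨ ∑-allVecs-suc (suc n) f ⟩
      ∑[ y ∈ elements ] ∑[ v ∈ allVecs F (suc n) ] f (y ∷ v)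
        ≡⟨ ∑-cong elements (λ y → ∑-allVecs-insertAt n i (f ∘ (y ∷_))) ⟩
      ∑[ y ∈ elements ] ∑[ w ∈ allVecs F n ] ∑[ x ∈ elements ] f (y ∷ insertAt w i x)
        ≡⟨ ∑-allVecs-suc n (λ w → ∑[ x ∈ elements ] f (insertAt w (suc i) x)) ⟨
      ∑[ w ∈ allVecs F (suc n) ] ∑[ x ∈ elements ] f (insertAt w (suc i) x) ∎

  ∑-allVecs-1 : ∀ n → ∑[ v ∈ allVecs F n ] 1 ≡ order ^ n
  ∑-allVecs-1 zero    = ≡.refl
  ∑-allVecs-1 (suc n) = begin
    ∑[ v ∈ allVecs F (suc n) ] 1           ≡⟨ ∑-allVecs-suc n (λ _ → 1) ⟩
    ∑[ x ∈ elements ] ∑[ v ∈ allVecs F n ] 1 ≡⟨ ∑-cong elements (λ _ → ∑-allVecs-1 n) ⟩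
    ∑[ x ∈ elements ] order ^ n            ≡⟨ ∑-const elements (order ^ n) ⟩
    order ^ suc n                          ∎

  _≋_ : ∀ {n} → Vec Carrier n → Vec Carrier n → Set (c ⊔ ℓ)
  _≋_ = Pointwise _≈_

  allVecs-complete : ∀ n (v : Vec Carrier n) → Any (v ≋_) (allVecs F n)
  allVecs-complete zero    []      = here []
  allVecs-complete (suc n) (x ∷ v) =
    AnyP.concatMap⁺ (λ y → List.map (y ∷_) (allVecs F n))
      (Any.map (λ x≈y → AnyP.map⁺ (Any.map (x≈y ∷_) (allVecs-complete n v))) (complete x))

  ∃-vec? : ∀ {q} n (Q : Vec Carrier n → Set q) → (∀ {u v} → u ≋ v → Q u → Q v) → Decidable Q → Dec (∃ Q)
  ∃-vec? n Q resp Q? with Any.any? Q? (allVecs F n)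
  ... | yes hit = yes (Any.satisfied hit)
  ... | no miss = no λ (v , Qv) → miss (Any.map (λ v≋u → resp v≋u Qv) (allVecs-complete n v))

module LinearSystems {c ℓ} (F : FiniteField c ℓ) where

  open FiniteField F hiding (zero) renaming (_+_ to _⊕_; _*_ to _·_)
  open import Algebra.Properties.Ring ring using (-‿distribˡ-*; -‿involutive; +-inverseˡ-unique)
  open import Algebra.Properties.CommutativeSemigroup *-commutativeSemigroup using (x∙yz≈y∙xz; xy∙z≈zx∙y; xy∙z≈yz∙x)
  open import Relation.Binary.Reasoning.Setoid setoid
  open SumFin F

  infix 7 _∙_
  _∙_ : ∀ {m} → Vec Carrier m → (Fin m → Carrier) → Carrier
  _∙_ {m} p e = sumFin F m (λ j → Vec.lookup p j · e j)

  IsNonzero : ∀ {m} → Vec Carrier m → Set ℓ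
  IsNonzero p = ∃ λ j → ¬ Vec.lookup p j ≈ 0#

  Solves : ∀ {m} → Vec Carrier m → List (Fin m → Carrier) → Set (c ⊔ ℓ)
  Solves p eqs = All (λ e → p ∙ e ≈ 0#) eqs

  ∙-∷ʳ : ∀ {m} (p : Vec Carrier m) y e → (p ∷ʳ y) ∙ e ≈ p ∙ (e ∘ inject₁) ⊕ y · e (fromℕ m)
  ∙-∷ʳ []      y e = trans (+-identityʳ _) (sym (+-identityˡ _))
  ∙-∷ʳ (x ∷ p) y e = trans (+-congˡ (∙-∷ʳ p y (e ∘ suc))) (sym (+-assoc _ _ _))

  isNonzero-∷ʳ : ∀ {m} (p : Vec Carrier m) y → IsNonzero p → IsNonzero (p ∷ʳ y)
  isNonzero-∷ʳ (x ∷ p) y (zero  , x≉0)  = zero , x≉0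
  isNonzero-∷ʳ (x ∷ p) y (suc j , pⱼ≉0) with j′ , nz ← isNonzero-∷ʳ p y (j , pⱼ≉0) = suc j′ , nz

  isNonzero-init : ∀ {m} (p : Vec Carrier m) {y} → y ≈ 0# → IsNonzero (p ∷ʳ y) → IsNonzero p
  isNonzero-init []      y≈0 (zero  , y≉0) = ⊥-elim (y≉0 y≈0)
  isNonzero-init (x ∷ p) y≈0 (zero  , x≉0) = zero , x≉0
  isNonzero-init (x ∷ p) y≈0 (suc j , nz)  with j′ , nz′ ← isNonzero-init p y≈0 (j , nz) = suc j′ , nz′

  ∙-linear : ∀ {m} (p : Vec Carrier m) a b e e′ → p ∙ (λ j → a · e j ⊕ b · e′ j) ≈ a · (p ∙ e) ⊕ b · (p ∙ e′)
  ∙-linear {m} p a b e e′ = trans (sumFin-cong m λ j → trans (distribˡ _ _ _) (+-cong (x∙yz≈y∙xz _ a _) (x∙yz≈y∙xz _ b _)))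
                                  (sumFin-linear m a b _ _)

  -- The first coefficient of f − (f zero · z) e* vanishes when z inverts e* zero, and reduce drops it;
  -- it is written as a linear combination so that ∙-linear applies.
  reduce : ∀ {m} (e* : Fin (suc m) → Carrier) (z : Carrier) → (Fin (suc m) → Carrier) → Fin m → Carrier
  reduce e* z f j = 1# · f (suc j) ⊕ (- (f zero · z)) · e* (suc j)

  backSubstitute : ∀ {m} (e* : Fin (suc m) → Carrier) (z : Carrier) → Vec Carrier m → Vec Carrier (suc m)
  backSubstitute e* z p′ = - (z · (p′ ∙ (e* ∘ suc))) ∷ p′

  backSubstitute-pivot : ∀ {m} (e* : Fin (suc m) → Carrier) z → e* zero · z ≈ 1# → (p′ : Vec Carrier m) →
                         backSubstitute e* z p′ ∙ e* ≈ 0#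
  backSubstitute-pivot e* z e*₀·z≈1 p′ = begin
    - (z · S) · e* zero ⊕ S   ≈⟨ +-congʳ (-‿distribˡ-* (z · S) (e* zero)) ⟨
    - ((z · S) · e* zero) ⊕ S ≈⟨ +-congʳ (-‿cong (trans (xy∙z≈zx∙y z S (e* zero)) (*-congʳ e*₀·z≈1))) ⟩
    - (1# · S) ⊕ S            ≈⟨ +-congʳ (-‿cong (*-identityˡ S)) ⟩
    - S ⊕ S                   ≈⟨ -‿inverseˡ S ⟩
    0#                        ∎
    where
    S : Carrier
    S = p′ ∙ (e* ∘ suc)

  backSubstitute-reduced : ∀ {m} (e* : Fin (suc m) → Carrier) z (p′ : Vec Carrier m) f →
                           p′ ∙ reduce e* z f ≈ 0# → backSubstitute e* z p′ ∙ f ≈ 0#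
  backSubstitute-reduced e* z p′ f reduced = begin
    - (z · S) · f zero ⊕ Sf     ≈⟨ +-congˡ Sf≈k·S ⟩
    - (z · S) · f zero ⊕ k · S  ≈⟨ +-congˡ (xy∙z≈yz∙x (f zero) z S) ⟩
    - (z · S) · f zero ⊕ (z · S) · f zero ≈⟨ +-congʳ (-‿distribˡ-* _ _) ⟨
    - ((z · S) · f zero) ⊕ (z · S) · f zero ≈⟨ -‿inverseˡ _ ⟩
    0#                          ∎
    where
    S Sf k : Carrier
    S  = p′ ∙ (e* ∘ suc)
    Sf = p′ ∙ (f ∘ suc)
    k  = f zero · z
    Sf≈k·S : Sf ≈ k · S
    Sf≈k·S = begin
      Sf                 ≈⟨ *-identityˡ Sf ⟨
      1# · Sf            ≈⟨ +-inverseˡ-unique _ _ (trans (sym (∙-linear p′ 1# (- k) (f ∘ suc) (e* ∘ suc))) reduced) ⟩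
      - ((- k) · S)      ≈⟨ -‿distribˡ-* (- k) S ⟩
      (- (- k)) · S      ≈⟨ *-congʳ (-‿involutive k) ⟩
      k · S              ∎

  private
    length-map-─ : ∀ {a b p m} {A : Set a} {B : Set b} {P : A → Set p} {xs : List A} {f : A → B} →
                   (x∈xs : Any P xs) → length xs < suc m → length (List.map f (xs Any.─ x∈xs)) < m
    length-map-─ {xs = xs} {f} x∈xs len<m rewrite ListP.length-map f (xs Any.─ x∈xs) =
      ℕ.s<s⁻¹ (≡.subst (_< suc _) (ListP.length-removeAt′ xs (Any.index x∈xs)) len<m)

  solves-backSubstitute : ∀ {m} {eqs : List (Fin (suc m) → Carrier)} (pivot : Any (λ e → ¬ e zero ≈ 0#) eqs) z →
                          Any.lookup pivot zero · z ≈ 1# → (p′ : Vec Carrier m) →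
                          Solves p′ (List.map (reduce (Any.lookup pivot) z) (eqs Any.─ pivot)) →
                          Solves (backSubstitute (Any.lookup pivot) z p′) eqs
  solves-backSubstitute pivot z e*₀·z≈1 p′ p′-solves =
    AllP.─⁻ pivot (backSubstitute-pivot (Any.lookup pivot) z e*₀·z≈1 p′)
            (All.map (λ {f} → backSubstitute-reduced (Any.lookup pivot) z p′ f) (AllP.map⁻ p′-solves))

  underdetermined : ∀ m (eqs : List (Fin m → Carrier)) → length eqs < m → ∃ λ p → IsNonzero p × Solves p eqs
  underdetermined (suc m) eqs len<m with All.all? (λ e → e zero ≟ 0#) eqs
  ... | yes first≈0 = 1# ∷ Vec.replicate m 0# , (zero , 0≉1 ∘ sym) , All.map (λ {e} → solves e) first≈0
    where
    solves : ∀ e → e zero ≈ 0# → (1# ∷ Vec.replicate m 0#) ∙ e ≈ 0#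
    solves e e₀≈0 = begin
      1# · e zero ⊕ Vec.replicate m 0# ∙ (e ∘ suc)
        ≈⟨ +-cong (*-identityˡ _) (sumFin-zero m λ j → trans (*-congʳ (reflexive (VecP.lookup-replicate j 0#))) (zeroˡ _)) ⟩
      e zero ⊕ 0#  ≈⟨ +-identityʳ _ ⟩
      e zero       ≈⟨ e₀≈0 ⟩
      0#           ∎
  ... | no ¬first≈0 with pivot ← AllP.¬All⇒Any¬ (λ e → e zero ≟ 0#) eqs ¬first≈0
                     with inverse (Any.lookup pivot zero) (AnyP.lookup-result pivot)
  ... | z , e*₀·z≈1
      with underdetermined m (List.map (reduce (Any.lookup pivot) z) (eqs Any.─ pivot)) (length-map-─ pivot len<m)
  ... | p′ , (j , p′ⱼ≉0) , p′-solves =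
        backSubstitute (Any.lookup pivot) z p′ , (suc j , p′ⱼ≉0) , solves-backSubstitute pivot z e*₀·z≈1 p′ p′-solves

module HankelKernels {c ℓ} (F : FiniteField c ℓ) where

  open import Data.Integer as ℤ using (ℤ; +_; -[1+_])
  import Data.Integer.Properties as ℤ
  open FiniteField F hiding (zero) renaming (_+_ to _⊕_; _*_ to _·_)
  open import Algebra.Properties.Ring ring using (-‿distribʳ-*)
  open import Relation.Binary.Reasoning.Setoid setoid
  open SumFin F using (sumFin-cong)
  open LinearSystems F
  open Enumeration F using (_≋_; ∃-vec?)

  -- h k plays the role of h_{k+1}; hAt F h a is h_a, with h_0 = 1 and h_a = 0 for a < 0.
  row : ∀ {m} → (ℕ → Carrier) → ℤ → Fin m → Carrier
  row h r j = hAt F h (r ℤ.+ + toℕ j)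

  Annihilates : ∀ {m} → Vec Carrier m → (ℕ → Carrier) → List ℤ → Set ℓ
  Annihilates p h R = All (λ r → p ∙ row h r ≈ 0#) R

  HasKernel : ℕ → List ℤ → (ℕ → Carrier) → Set (c ⊔ ℓ)
  HasKernel m R h = ∃ λ (p : Vec Carrier m) → IsNonzero p × Annihilates p h R

  hasKernel? : ∀ m R h → Dec (HasKernel m R h)
  hasKernel? m R h = ∃-vec? m Kernel respects λ p →
    Fin.any? (λ j → ¬? (Vec.lookup p j ≟ 0#)) ×-dec All.all? (λ r → (p ∙ row h r) ≟ 0#) R
    where
    Kernel : Vec Carrier m → Set ℓ
    Kernel p = IsNonzero p × Annihilates p h R
    respects : ∀ {p q} → p ≋ q → Kernel p → Kernel q
    respects p≋q ((j , pⱼ≉0) , solves) =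
      (j , λ qⱼ≈0 → pⱼ≉0 (trans (Pointwise.lookup p≋q j) qⱼ≈0)) ,
      All.map (trans (sym (sumFin-cong m λ j → *-congʳ (Pointwise.lookup p≋q j)))) solves

  ∙-∷ʳ-row : ∀ {m} (p : Vec Carrier m) y h r → (p ∷ʳ y) ∙ row h r ≈ p ∙ row h r ⊕ y · hAt F h (r ℤ.+ + m)
  ∙-∷ʳ-row {m} p y h r = trans (∙-∷ʳ p y (row h r)) (+-cong
    (sumFin-cong m λ j → *-congˡ (reflexive (≡.cong (λ t → hAt F h (r ℤ.+ + t)) (Fin.toℕ-inject₁ j))))
    (*-congˡ (reflexive (≡.cong (λ t → hAt F h (r ℤ.+ + t)) (Fin.toℕ-fromℕ m)))))

  hasKernel-pad : ∀ {m R h} → HasKernel m R h → HasKernel (suc m) R h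
  hasKernel-pad {h = h} (p , nz , solves) = p ∷ʳ 0# , isNonzero-∷ʳ p 0# nz , All.map (λ {r} → pad r) solves
    where
    pad : ∀ r → p ∙ row h r ≈ 0# → (p ∷ʳ 0#) ∙ row h r ≈ 0#
    pad r p∙r≈0 = trans (∙-∷ʳ-row p 0# h r) (trans (+-cong p∙r≈0 (zeroˡ _)) (+-identityʳ 0#))

  ∙-row-cong : ∀ {m} (p : Vec Carrier m) h h′ r → (∀ j → row h r j ≈ row h′ r j) → p ∙ row h r ≈ p ∙ row h′ r
  ∙-row-cong {m} p h h′ r same = sumFin-cong m λ j → *-congˡ (same j)

  annihilates-transfer : ∀ {m} (p : Vec Carrier m) {h h′ R} → All (λ r → ∀ j → row h r j ≈ row {m} h′ r j) R →
                         Annihilates p h R → Annihilates p h′ R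
  annihilates-transfer p {h} {h′} same solves =
    All.zipWith (λ {r} (sameᵣ , solvesᵣ) → trans (sym (∙-row-cong p h h′ r sameᵣ)) solvesᵣ) (same , solves)

  AgreeBelow : ℕ → (ℕ → Carrier) → (ℕ → Carrier) → Set ℓ
  AgreeBelow B h h′ = ∀ k → k < B → h k ≈ h′ k

  RowWithin : ℕ → ℤ → ℕ → Set
  RowWithin m r B = ∀ (j : Fin m) → r ℤ.+ + toℕ j ℤ.≤ + B

  row-agree : ∀ {m B h h′} → AgreeBelow B h h′ → ∀ r → RowWithin m r B → ∀ j → row h r j ≈ row h′ r j
  row-agree {B = B} {h} {h′} agree r within j = hAt-agree (r ℤ.+ + toℕ j) (within j)
    where
    hAt-agree : ∀ a → a ℤ.≤ + B → hAt F h a ≈ hAt F h′ a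
    hAt-agree -[1+ n ]  _           = refl
    hAt-agree (+ zero)  _           = refl
    hAt-agree (+ suc k) (ℤ.+≤+ k<B) = agree k k<B

  annihilates-agree : ∀ {m} (p : Vec Carrier m) {B h h′ R} → AgreeBelow B h h′ → All (λ r → RowWithin m r B) R →
                      Annihilates p h R → Annihilates p h′ R
  annihilates-agree p agree within = annihilates-transfer p (All.map (λ {r} → row-agree agree r) within)

  hasKernel-agree : ∀ {m B h h′ R} → AgreeBelow B h h′ → All (λ r → RowWithin m r B) R →
                    HasKernel m R h → HasKernel m R h′
  hasKernel-agree agree within (p , nz , solves) = p , nz , annihilates-agree p agree within solves

  rows-within : ∀ {ρ m n R} → n ≤ suc m → All (ℤ._≤ + ρ) R → All (λ r → RowWithin n r (ρ + m)) R
  rows-within n≤1+m = All.map λ r≤ρ j → ℤ.+-mono-≤ r≤ρ (ℤ.+≤+ (ℕ.≤-pred (ℕ.≤-trans (Fin.toℕ<n j) n≤1+m)))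

  top-within : ∀ ρ m → RowWithin m (+ suc ρ) (ρ + m)
  top-within ρ m j = ℤ.+≤+ (≡.subst (_≤ ρ + m) (ℕ.+-suc ρ (toℕ j)) (ℕ.+-monoʳ-≤ ρ (Fin.toℕ<n j)))

  hasKernel-resp : ∀ {m R h h′} → (∀ k → h k ≈ h′ k) → HasKernel m R h → HasKernel m R h′
  hasKernel-resp {R = R} {h} {h′} h≈h′ (p , nz , solves) =
    p , nz , annihilates-transfer p (All.universal (λ r j → hAt-cong (r ℤ.+ + toℕ j)) R) solves
    where
    hAt-cong : ∀ a → hAt F h a ≈ hAt F h′ a
    hAt-cong -[1+ n ]  = refl
    hAt-cong (+ zero)  = refl
    hAt-cong (+ suc k) = h≈h′ k

  -- In the top row + suc ρ the last unknown multiplies h x (ρ + m) ≈ x, an entry occurring nowhere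
  -- else; so if its coefficient is nonzero, x can be chosen to make the top row hold.
  hasKernel-extend : ∀ {m ρ R} (h : Carrier → ℕ → Carrier) → (∀ x x′ → AgreeBelow (ρ + m) (h x) (h x′)) →
                     (∀ x → h x (ρ + m) ≈ x) → All (λ r → RowWithin (suc m) r (ρ + m)) R → HasKernel (suc m) R (h 0#) →
                     HasKernel m R (h 0#) ⊎ ∃ λ x → HasKernel (suc m) (+ suc ρ ∷ R) (h x)
  hasKernel-extend {m} {ρ} {R} h agree h-at within (p , nz , solves) with ys , y , ≡.refl ← Vec.initLast p
                                                                     with y ≟ 0#
  ... | yes y≈0 = inj₁ (ys , isNonzero-init ys y≈0 nz , All.map (λ {r} → drop-last r) solves)
    where
    drop-last : ∀ r → (ys ∷ʳ y) ∙ row (h 0#) r ≈ 0# → ys ∙ row (h 0#) r ≈ 0#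
    drop-last r solves-r = begin
      ys ∙ row (h 0#) r                                   ≈⟨ +-identityʳ _ ⟨
      ys ∙ row (h 0#) r ⊕ 0#                              ≈⟨ +-congˡ (trans (*-congʳ y≈0) (zeroˡ _)) ⟨
      ys ∙ row (h 0#) r ⊕ y · hAt F (h 0#) (r ℤ.+ + m)    ≈⟨ ∙-∷ʳ-row ys y (h 0#) r ⟨
      (ys ∷ʳ y) ∙ row (h 0#) r                            ≈⟨ solves-r ⟩
      0#                                                  ∎
  ... | no y≉0 with z , y·z≈1 ← inverse y y≉0 =
    inj₂ (x , ys ∷ʳ y , nz , top-row ∷ annihilates-agree (ys ∷ʳ y) (agree 0# x) within solves)
    where
    L x : Carrier
    L = ys ∙ row (h 0#) (+ suc ρ)
    x = - (z · L)
    top-row : (ys ∷ʳ y) ∙ row (h x) (+ suc ρ) ≈ 0#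
    top-row = begin
      (ys ∷ʳ y) ∙ row (h x) (+ suc ρ)
        ≈⟨ ∙-∷ʳ-row ys y (h x) (+ suc ρ) ⟩
      ys ∙ row (h x) (+ suc ρ) ⊕ y · h x (ρ + m)
        ≈⟨ +-cong (∙-row-cong ys (h x) (h 0#) (+ suc ρ) (row-agree (agree x 0#) (+ suc ρ) (top-within ρ m)))
                  (*-congˡ (h-at x)) ⟩
      L ⊕ y · x
        ≈⟨ +-congˡ (-‿distribʳ-* y (z · L)) ⟨
      L ⊕ - (y · (z · L))
        ≈⟨ +-congˡ (-‿cong (trans (sym (*-assoc y z L)) (trans (*-congʳ y·z≈1) (*-identityˡ L)))) ⟩
      L ⊕ - L
        ≈⟨ -‿inverseʳ L ⟩
      0# ∎

module KernelCounting {c ℓ} (F : FiniteField c ℓ) where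

  open import Data.Integer as ℤ using (ℤ; +_)
  open FiniteField F using (Carrier; _≈_; 0#; elements; complete; order; reflexive; sym; trans)
  open ListSum
  open Enumeration F using (∑-allVecs-insertAt; ∑-allVecs-1)
  open HankelKernels F

  hOf : ∀ {N} → Vec Carrier N → ℕ → Carrier
  hOf v = hOfList F (Vec.toList v)

  hOf-insertAt-≡ : ∀ {N} (w : Vec Carrier N) i x → hOf (insertAt w i x) (toℕ i) ≡ x
  hOf-insertAt-≡ w       zero    x = ≡.refl
  hOf-insertAt-≡ (y ∷ w) (suc i) x = hOf-insertAt-≡ w i x

  hOf-insertAt-≢ : ∀ {N} (w : Vec Carrier N) i x x′ k → k ≢ toℕ i → hOf (insertAt w i x) k ≡ hOf (insertAt w i x′) k
  hOf-insertAt-≢ w       zero    x x′ zero    k≢i = ⊥-elim (k≢i ≡.refl)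
  hOf-insertAt-≢ w       zero    x x′ (suc k) k≢i = ≡.refl
  hOf-insertAt-≢ (y ∷ w) (suc i) x x′ zero    k≢i = ≡.refl
  hOf-insertAt-≢ (y ∷ w) (suc i) x x′ (suc k) k≢i = hOf-insertAt-≢ w i x x′ k (k≢i ∘ ≡.cong suc)

  kernelCount : ℕ → ℕ → List ℤ → ℕ
  kernelCount N m R = ∑[ v ∈ allVecs F N ] 𝟙 (hasKernel? m R (hOf v))

  kernelCount-0 : ∀ N R → kernelCount N 0 R ≡ 0
  kernelCount-0 N R = ≡.trans (∑-cong (allVecs F N) λ v → 𝟙-no (hasKernel? 0 R (hOf v)) λ { (_ , (() , _) , _) })
                              (≡.trans (∑-const (allVecs F N) 0) (ℕ.*-zeroʳ (length (allVecs F N))))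

  -- Splitting off the coordinate h_{ρ+m+1} of (h_1, …, h_{N+1}): every count becomes a sum over the
  -- other coordinates w of a fiber count over its value x.
  module Fibers {N ρ m : ℕ} (R : List ℤ) (R≤ρ : All (ℤ._≤ + ρ) R) (i<1+N : ρ + m < suc N) where

    i : Fin (suc N)
    i = fromℕ< i<1+N

    h : Vec Carrier N → Carrier → ℕ → Carrier
    h w x = hOf (insertAt w i x)

    toℕ-i : toℕ i ≡ ρ + m
    toℕ-i = Fin.toℕ-fromℕ< i<1+N

    h-agree : ∀ w x x′ → AgreeBelow (ρ + m) (h w x) (h w x′)
    h-agree w x x′ k k<ρ+m = reflexive (hOf-insertAt-≢ w i x x′ k λ k≡i → ℕ.<-irrefl (≡.trans k≡i toℕ-i) k<ρ+m)

    h-at : ∀ w x → h w x (ρ + m) ≈ x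
    h-at w x = reflexive (≡.trans (≡.cong (h w x) (≡.sym toℕ-i)) (hOf-insertAt-≡ w i x))

    h-resp : ∀ w {x x′} → x ≈ x′ → ∀ k → h w x k ≈ h w x′ k
    h-resp w {x} {x′} x≈x′ k with k ℕ.≟ ρ + m
    ... | yes ≡.refl = trans (h-at w x) (trans x≈x′ (sym (h-at w x′)))
    ... | no k≢ρ+m   = reflexive (hOf-insertAt-≢ w i x x′ k (λ k≡i → k≢ρ+m (≡.trans k≡i toℕ-i)))

    fiber : ℕ → List ℤ → Vec Carrier N → ℕ
    fiber n R′ w = ∑[ x ∈ elements ] 𝟙 (hasKernel? n R′ (h w x))

    kernelCount-fibers : ∀ n R′ → kernelCount (suc N) n R′ ≡ ∑[ w ∈ allVecs F N ] fiber n R′ w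
    kernelCount-fibers n R′ = ∑-allVecs-insertAt N i _

    fiber-constant : ∀ {n R′} → All (λ r → RowWithin n r (ρ + m)) R′ → ∀ w →
                     fiber n R′ w ≡ order * 𝟙 (hasKernel? n R′ (h w 0#))
    fiber-constant {n} {R′} within w = ≡.trans
      (∑-cong elements λ x → 𝟙-cong (hasKernel? n R′ (h w x)) (hasKernel? n R′ (h w 0#))
                                    (hasKernel-agree (h-agree w x 0#) within) (hasKernel-agree (h-agree w 0# x) within))
      (∑-const elements _)

    top : ℤ
    top = + suc ρ

    R-within : ∀ {n} → n ≤ suc m → All (λ r → RowWithin n r (ρ + m)) R
    R-within n≤1+m = rows-within n≤1+m R≤ρ

    𝟙-hasKernel-extend : ∀ w → 𝟙 (hasKernel? (suc m) R (h w 0#)) ≤ 𝟙 (hasKernel? m R (h w 0#)) + fiber (suc m) (top ∷ R) w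
    𝟙-hasKernel-extend w with hasKernel? (suc m) R (h w 0#)
    ... | no _  = z≤n
    ... | yes K with hasKernel-extend (h w) (h-agree w) (h-at w) (R-within ℕ.≤-refl) K
    ...   | inj₁ K-R       = ℕ.≤-trans (ℕ.≤-reflexive (≡.sym (𝟙-yes (hasKernel? m R (h w 0#)) K-R))) (ℕ.m≤m+n _ _)
    ...   | inj₂ (x , K-x) = ℕ.≤-trans positive (ℕ.m≤n+m _ _)
      where
      positive : 1 ≤ fiber (suc m) (top ∷ R) w
      positive = ∑-positive elements _ (complete x) λ x′ x≈x′ →
        ℕ.≤-reflexive (≡.sym (𝟙-yes (hasKernel? (suc m) (top ∷ R) (h w x′)) (hasKernel-resp (h-resp w x≈x′) K-x)))

    indicator-step : ∀ w → 𝟙 (hasKernel? (suc m) R (h w 0#)) + order * 𝟙 (hasKernel? m (top ∷ R) (h w 0#))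
                       ≤ 𝟙 (hasKernel? m R (h w 0#)) + fiber (suc m) (top ∷ R) w
    indicator-step w with hasKernel? m (top ∷ R) (h w 0#)
    ... | no _ rewrite ℕ.*-zeroʳ order | ℕ.+-identityʳ (𝟙 (hasKernel? (suc m) R (h w 0#))) = 𝟙-hasKernel-extend w
    ... | yes K-top@(p , nz , _ ∷ solves-R) = ℕ.+-mono-≤ D≤B (ℕ.≤-reflexive full)
      where
      D≤B : 𝟙 (hasKernel? (suc m) R (h w 0#)) ≤ 𝟙 (hasKernel? m R (h w 0#))
      D≤B = 𝟙-mono (hasKernel? (suc m) R (h w 0#)) (hasKernel? m R (h w 0#)) λ _ → p , nz , solves-R
      full : order * 1 ≡ fiber (suc m) (top ∷ R) w
      full = ≡.trans (≡.sym (∑-const elements 1)) (∑-cong elements λ x → ≡.sym (𝟙-yes (hasKernel? (suc m) (top ∷ R) (h w x))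
               (hasKernel-pad (hasKernel-agree (h-agree w 0# x) (top-within ρ m ∷ R-within (ℕ.n≤1+n m)) K-top))))

    fiber-step : ∀ w → fiber (suc m) R w + order * fiber m (top ∷ R) w ≤ fiber m R w + order * fiber (suc m) (top ∷ R) w
    fiber-step w = begin
      fiber (suc m) R w + order * fiber m (top ∷ R) w
        ≡⟨ ≡.cong₂ (λ a b → a + order * b) (fiber-constant (R-within ℕ.≤-refl) w)
                                           (fiber-constant (top-within ρ m ∷ R-within (ℕ.n≤1+n m)) w) ⟩
      order * D + order * (order * A)
        ≡⟨ ℕ.*-distribˡ-+ order D (order * A) ⟨
      order * (D + order * A)
        ≤⟨ ℕ.*-monoʳ-≤ order (indicator-step w) ⟩
      order * (B + fiber (suc m) (top ∷ R) w)
        ≡⟨ ℕ.*-distribˡ-+ order B _ ⟩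
      order * B + order * fiber (suc m) (top ∷ R) w
        ≡⟨ ≡.cong (_+ order * fiber (suc m) (top ∷ R) w) (fiber-constant (R-within (ℕ.n≤1+n m)) w) ⟨
      fiber m R w + order * fiber (suc m) (top ∷ R) w ∎
      where
      open ℕ.≤-Reasoning
      A B D : ℕ
      A = 𝟙 (hasKernel? m (top ∷ R) (h w 0#))
      B = 𝟙 (hasKernel? m R (h w 0#))
      D = 𝟙 (hasKernel? (suc m) R (h w 0#))

    kernelCount-step : kernelCount (suc N) (suc m) R + order * kernelCount (suc N) m (top ∷ R)
                       ≤ kernelCount (suc N) m R + order * kernelCount (suc N) (suc m) (top ∷ R)
    kernelCount-step = begin
      kernelCount (suc N) (suc m) R + order * kernelCount (suc N) m (top ∷ R) ≡⟨ as-fibers (suc m) R m (top ∷ R) ⟩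
      ∑[ w ∈ allVecs F N ] (fiber (suc m) R w + order * fiber m (top ∷ R) w)  ≤⟨ ∑-mono (allVecs F N) fiber-step ⟩
      ∑[ w ∈ allVecs F N ] (fiber m R w + order * fiber (suc m) (top ∷ R) w)  ≡⟨ as-fibers m R (suc m) (top ∷ R) ⟨
      kernelCount (suc N) m R + order * kernelCount (suc N) (suc m) (top ∷ R) ∎
      where
      open ℕ.≤-Reasoning
      as-fibers : ∀ n R′ n′ R″ → kernelCount (suc N) n R′ + order * kernelCount (suc N) n′ R″
                                 ≡ ∑[ w ∈ allVecs F N ] (fiber n R′ w + order * fiber n′ R″ w)
      as-fibers n R′ n′ R″ = ≡.trans
        (≡.cong₂ (λ a b → a + order * b) (kernelCount-fibers n R′) (kernelCount-fibers n′ R″))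
        (≡.sym (≡.trans (∑-distrib-+ (allVecs F N) (fiber n R′) _)
                        (≡.cong (λ t → ∑ (allVecs F N) (fiber n R′) + t) (*-distribˡ-∑ (allVecs F N) order (fiber n′ R″)))))

  kernelCount-top : ∀ {N ρ} m R → All (ℤ._≤ + ρ) R → ρ + m ≤ N →
                    kernelCount N m R ≤ order * kernelCount N m (+ suc ρ ∷ R)
  kernelCount-top {N} zero R _ _ = ℕ.≤-trans (ℕ.≤-reflexive (kernelCount-0 N R)) z≤n
  kernelCount-top {zero} {ρ} (suc m) R _ ρ+1+m≤0 = ⊥-elim (ℕ.<⇒≱ (ℕ.s≤s z≤n) (≡.subst (_≤ 0) (ℕ.+-suc ρ m) ρ+1+m≤0))
  kernelCount-top {suc N} {ρ} (suc m) R R≤ρ bound =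
    ℕ.+-cancelˡ-≤ (order * c₀) _ _ (begin
      order * c₀ + C₁                  ≡⟨ ℕ.+-comm (order * c₀) C₁ ⟩
      C₁ + order * c₀                  ≤⟨ kernelCount-step ⟩
      b₀ + order * C₁′                 ≤⟨ ℕ.+-monoˡ-≤ (order * C₁′) IH ⟩
      order * c₀ + order * C₁′         ∎)
    where
    open ℕ.≤-Reasoning
    ρ+m<1+N : ρ + m < suc N
    ρ+m<1+N = ≡.subst (_≤ suc N) (ℕ.+-suc ρ m) bound
    open Fibers R R≤ρ ρ+m<1+N using (kernelCount-step)
    C₁ C₁′ b₀ c₀ : ℕ
    C₁  = kernelCount (suc N) (suc m) R
    C₁′ = kernelCount (suc N) (suc m) (+ suc ρ ∷ R)
    b₀  = kernelCount (suc N) m R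
    c₀  = kernelCount (suc N) m (+ suc ρ ∷ R)
    IH : b₀ ≤ order * c₀
    IH = kernelCount-top m R R≤ρ (ℕ.<⇒≤ ρ+m<1+N)

module JacobiTrudi {c ℓ} (F : FiniteField c ℓ) where

  open import Data.Integer as ℤ using (ℤ; +_)
  import Data.Integer.Properties as ℤ
  open FiniteField F using (_≈_; 0#; _≟_; order)
  open ListSum
  open LinearSystems F using (underdetermined)
  open Determinant F using (det-dependent-columns)
  open Enumeration F using (∑-allVecs-1)
  open HankelKernels F
  open KernelCounting F

  jtRow : (λp : List ℕ) → Fin (length λp) → ℤ
  jtRow λp i = + Vec.lookup (Vec.fromList λp) i ℤ.- + toℕ i

  schurImage≈0 : ∀ λp h → HasKernel (length λp) (List.tabulate (jtRow λp)) h → schurImage F h λp ≈ 0#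
  schurImage≈0 λp h (p , (k , pₖ≉0) , solves) =
    det-dependent-columns (length λp) _ (Vec.lookup p) k pₖ≉0 (AllP.tabulate⁻ solves)

  kernelCount≤zeroCount : ∀ λp N → kernelCount N (length λp) (List.tabulate (jtRow λp)) ≤ zeroCount F λp N
  kernelCount≤zeroCount λp N = ℕ.≤-trans
    (∑-mono (allVecs F N) λ v → 𝟙-mono (hasKernel? _ _ (hOf v)) (schurImage F (hOf v) λp ≟ 0#) (schurImage≈0 λp (hOf v)))
    (ℕ.≤-reflexive (≡.sym (length-filter (λ v → schurImage F (hOf v) λp ≟ 0#) (allVecs F N))))

  kernelCount-underdetermined : ∀ N m R → length R < m → kernelCount N m R ≡ order ^ N
  kernelCount-underdetermined N m R fewer = ≡.trans (∑-cong (allVecs F N) λ v → 𝟙-yes (hasKernel? m R (hOf v)) (kernel v))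
                                                    (∑-allVecs-1 N)
    where
    kernel : ∀ v → HasKernel m R (hOf v)
    kernel v with p , nz , solves ← underdetermined m (List.map (row (hOf v)) R)
                                      (≡.subst (_< m) (≡.sym (ListP.length-map (row (hOf v)) R)) fewer)
      = p , nz , AllP.map⁻ solves

  jtRows-below-first : ∀ ρ λs → Linked _≥_ (suc ρ ∷ λs) →
                       All (ℤ._≤ + ρ) (List.tabulate (jtRow (suc ρ ∷ λs) ∘ suc))
  jtRows-below-first ρ λs decreasing = AllP.tabulate⁺ λ i →
    below (VecAllP.lookup⁺ (VecAllP.fromList⁺ (All.tail (LinkedP.Linked⇒All ≥-trans ℕ.≤-refl decreasing))) i)
    where
    ≥-trans : ∀ {x y z} → x ≥ y → y ≥ z → x ≥ z
    ≥-trans x≥y y≥z = ℕ.≤-trans y≥z x≥y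
    below : ∀ {y k} → y ≤ suc ρ → + y ℤ.- + suc k ℤ.≤ + ρ
    below y≤1+ρ = ℤ.+-mono-≤ (ℤ.+≤+ y≤1+ρ) (ℤ.neg-mono-≤ (ℤ.+≤+ (s≤s z≤n)))

corollary5p2 : ∀ {c ℓ} (F : FiniteField c ℓ) (λp : List ℕ) → IsPartition λp → 1 ≤ length λp →
    (N : ℕ) → sum λp + length λp ≤ N →
    FiniteField.order F ^ N ≤ FiniteField.order F * zeroCount F λp N
corollary5p2 F []               _                ()  N _
corollary5p2 F (zero ∷ λs)      (_ , () ∷ _)     _   N _
corollary5p2 F λp@(suc ρ ∷ λs) (decreasing , _) _   N bound = begin
  order ^ N
    ≡⟨ kernelCount-underdetermined N l R fewer ⟨
  kernelCount N l R
    ≤⟨ kernelCount-top l R (jtRows-below-first ρ λs decreasing) ρ+l≤N ⟩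
  order * kernelCount N l (+ suc ρ ∷ R)
    ≡⟨ ≡.cong (λ r → order * kernelCount N l (r ∷ R)) (ℤ.+-identityʳ (+ suc ρ)) ⟨
  order * kernelCount N l (List.tabulate (jtRow λp))
    ≤⟨ ℕ.*-monoʳ-≤ order (kernelCount≤zeroCount λp N) ⟩
  order * zeroCount F λp N ∎
  where
  open ℕ.≤-Reasoning
  open import Data.Integer using (ℤ; +_)
  import Data.Integer.Properties as ℤ
  open FiniteField F using (order)
  open KernelCounting F
  open JacobiTrudi F
  l : ℕ
  l = length λp
  R : List ℤ
  R = List.tabulate (jtRow λp ∘ suc)
  fewer : length R < l
  fewer = s≤s (ℕ.≤-reflexive (ListP.length-tabulate (jtRow λp ∘ suc)))
  ρ+l≤N : ρ + l ≤ N
  ρ+l≤N = ℕ.≤-trans (ℕ.+-monoˡ-≤ l (ℕ.≤-trans (ℕ.n≤1+n ρ) (ℕ.m≤m+n (suc ρ) (sum λs)))) bound
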